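{- Let $n>1$ and $q>1$ be integers such that $\binom{n-1}{k}\equiv (-1)^k \pmod{q}$ for every integer $k\in\{0,1,\ldots,n-1\}$. Then $q$ is a prime and $n$ is a power of $q$. -}

module Defs where

module Submission where

-- Two consequences of the congruences drive the proof:
--   (a) every C(N,k) is coprime to q, since a common divisor divides ±1;
--   (b) q divides C(n,k+1) for k < N, by Pascal's rule C(N,k) + C(N,k+1)
--       = C(n,k+1) and (-1)^k + (-1)^(k+1) = 0.
-- With the absorption identity j·C(n,j) = n·C(N,j-1) these give the key
-- lemma: every divisor j of n with j < n satisfies j·q ∣ n.  Indeed, writing
-- n = r·j we get j·q ∣ j·r·C(N,j-1), so q ∣ r·C(N,j-1), so q ∣ r by (a).
-- Iterating the key lemma from j = 1 shows q^b ∣ n for ever larger b until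
-- some q^b equals n; since n < q^n this must happen, so n is a power of q.
-- Finally, if n = q^(m+1) and d ∣ q with d < q, then j = d·q^m is a proper
-- divisor of n, so d·q^m·q ∣ q^(m+1) and d = 1: q is irreducible, hence prime.

open import Defs
open import Data.Nat using (ℕ; _<_; _∸_; _^_)
open import Data.Nat.Combinatorics using (_C_)
open import Data.Nat.Primality using (Prime)
open import Data.Integer using (ℤ; +_; _-_; -1ℤ) renaming (_^_ to _^ℤ_)
open import Data.Integer.Divisibility using (_∣_)
open import Data.Product using (_×_; ∃-syntax)
open import Relation.Binary.PropositionalEquality using (_≡_)

open import Data.Nat
  using (zero; suc; _+_; _*_; _/_; _≤_; _!; _≟_; NonZero; z<s; s<s; s<s⁻¹; s≤s;
         n>1⇒nonTrivial; nonTrivial⇒nonZero)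
open import Data.Nat.Properties
  using (*-comm; *-assoc; *-identityˡ; *-cancelʳ-≡; _!*_!≢0; m^n≢0; m<n⇒m<1+n; <⇒≤;
         m≤n⇒m<n∨m≡n; <-≤-trans; <-irrefl; <⇒≱; ^-monoʳ-<; *-identityʳ; n<1+n; *-monoˡ-<; ≤∧≢⇒<)
open import Data.Nat.Combinatorics using (nCk≡n!/k![n-k]!; k![n∸k]!∣n!; nCk+nC[k+1]≡[n+1]C[k+1])
open import Data.Nat.DivMod using (m/n*n≡m)
import Data.Nat.Divisibility as ℕ∣
open import Data.Nat.Coprimality using (Coprime; coprime-divisor)
open import Data.Nat.Primality using (Irreducible; irreducible⇒prime)
import Data.Integer as ℤ
import Data.Integer.Properties as ℤₚ
import Data.Integer.Divisibility.Signed as ℤ∣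
open import Data.Product using (_,_)
open import Data.Sum using (_⊎_; inj₁; inj₂)
open import Data.Empty using (⊥-elim)
open import Relation.Nullary using (yes; no)
open import Relation.Binary.PropositionalEquality using (refl; sym; trans; cong; subst; subst₂; module ≡-Reasoning)
import Data.Nat.Tactic.RingSolver as ℕRing
import Data.Integer.Tactic.RingSolver as ℤRing

open ≡-Reasoning

binomial-factorial : ∀ n k → k ≤ n → (n C k) * (k ! * (n ∸ k) !) ≡ n !
binomial-factorial n k k≤n = begin
  (n C k) * (k ! * (n ∸ k) !)                   ≡⟨ cong (_* (k ! * (n ∸ k) !)) (nCk≡n!/k![n-k]! k≤n) ⟩
  (n ! / (k ! * (n ∸ k) !)) * (k ! * (n ∸ k) !) ≡⟨ m/n*n≡m (k![n∸k]!∣n! k≤n) ⟩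
  n !                                           ∎
  where
  instance
    denominator≢0 : NonZero (k ! * (n ∸ k) !)
    denominator≢0 = k !* (n ∸ k) !≢0

-- Absorption: (k+1) · C(n+1,k+1) = (n+1) · C(n,k).  Both sides, multiplied by
-- k!·(n-k)!, equal (n+1)!.
absorption : ∀ n k → k ≤ n → suc k * (suc n C suc k) ≡ suc n * (n C k)
absorption n k k≤n = *-cancelʳ-≡ _ _ D {{k !* (n ∸ k) !≢0}} (begin
  (suc k * (suc n C suc k)) * D         ≡⟨ regroup (suc k) (suc n C suc k) (k !) ((n ∸ k) !) ⟩
  (suc n C suc k) * (suc k ! * (n ∸ k) !) ≡⟨ binomial-factorial (suc n) (suc k) (s≤s k≤n) ⟩
  suc n * n !                           ≡⟨ cong (suc n *_) (binomial-factorial n k k≤n) ⟨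
  suc n * ((n C k) * D)                 ≡⟨ *-assoc (suc n) (n C k) D ⟨
  (suc n * (n C k)) * D                 ∎)
  where
  D : ℕ
  D = k ! * (n ∸ k) !
  regroup : ∀ a b c d → (a * b) * (c * d) ≡ b * ((a * c) * d)
  regroup = ℕRing.solve-∀

sign : ℕ → ℤ
sign k = -1ℤ ^ℤ k

∣sign∣≡1 : ∀ k → ℤ.∣ sign k ∣ ≡ 1
∣sign∣≡1 zero    = refl
∣sign∣≡1 (suc k) = trans (ℤₚ.abs-* -1ℤ (sign k)) (trans (*-identityˡ _) (∣sign∣≡1 k))

sign-suc : ∀ k → sign (suc k) ≡ ℤ.- sign k
sign-suc k = ℤₚ.-1*i≡-i (sign k)

-- The statement's divisibility on ℤ is that of absolute values; moving to
-- the signed relation makes the usual divisibility algebra available.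
signed : ∀ m x → (+ m) ∣ x → (+ m) ℤ∣.∣ x
signed m x = ℤ∣.∣ᵤ⇒∣ {+ m} {x}

-- If a ≡ s (mod q) for a unit s = ±1, then a is coprime to q: a common
-- divisor of q and a divides a - (a - s) = s.
unit-congruence⇒coprime : ∀ {q a} s → (+ q) ∣ (+ a - s) → ℤ.∣ s ∣ ≡ 1 → Coprime q a
unit-congruence⇒coprime {q} {a} s q∣a-s ∣s∣≡1 {d} (d∣q , d∣a) =
  ℕ∣.∣1⇒≡1 (subst (d ℕ∣.∣_) (trans (ℤₚ.∣-i∣≡∣i∣ s) ∣s∣≡1) (ℤ∣.∣⇒∣ᵤ d∣-s))
  where
  d∣a-s : (+ d) ℤ∣.∣ (+ a - s)
  d∣a-s = ℤ∣.∣-trans (signed d (+ q) d∣q) (signed q (+ a - s) q∣a-s)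
  d∣-s : (+ d) ℤ∣.∣ ℤ.- s
  d∣-s = ℤ∣.∣m+n∣m⇒∣n d∣a-s (signed d (+ a) d∣a)

opposite-congruences⇒∣sum : ∀ {q} a b s → (+ q) ∣ (+ a - s) → (+ q) ∣ (+ b - ℤ.- s) →
                            q ℕ∣.∣ a + b
opposite-congruences⇒∣sum {q} a b s q∣a-s q∣b+s =
  subst (λ x → q ℕ∣.∣ ℤ.∣ x ∣) cancel-signs
    (ℤ∣.∣⇒∣ᵤ (ℤ∣.∣m∣n⇒∣m+n (signed q (+ a - s) q∣a-s) (signed q (+ b - ℤ.- s) q∣b+s)))
  where
  cancel-signs : (+ a - s) ℤ.+ (+ b - ℤ.- s) ≡ + (a + b)
  cancel-signs = trans (regroup (+ a) (+ b) s) (sym (ℤₚ.pos-+ a b))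
    where
    regroup : ∀ x y z → (x - z) ℤ.+ (y - ℤ.- z) ≡ x ℤ.+ y
    regroup = ℤRing.solve-∀

n<m^n : ∀ m → 1 < m → ∀ n → n < m ^ n
n<m^n m 1<m zero    = z<s
n<m^n m 1<m (suc n) = <-≤-trans (s<s (n<m^n m 1<m n)) (^-monoʳ-< m 1<m (n<1+n n))

module BinomialRowCongruence (N q : ℕ) (1<q : 1 < q)
  (row≡signs : ∀ k → k < suc N → (+ q) ∣ (+ (N C k) - sign k)) where

  row-coprime : ∀ k → k < suc N → Coprime q (N C k)
  row-coprime k k<n = unit-congruence⇒coprime (sign k) (row≡signs k k<n) (∣sign∣≡1 k)

  q∣next-row : ∀ k → k < N → q ℕ∣.∣ suc N C suc k
  q∣next-row k k<N = subst (q ℕ∣.∣_) (nCk+nC[k+1]≡[n+1]C[k+1] N k)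
    (opposite-congruences⇒∣sum (N C k) (N C suc k) (sign k) (row≡signs k (m<n⇒m<1+n k<N))
      (subst (λ s → (+ q) ∣ (+ (N C suc k) - s)) (sign-suc k) (row≡signs (suc k) (s<s k<N))))

  proper-divisor-lifts : ∀ j → j ℕ∣.∣ suc N → j < suc N → j * q ℕ∣.∣ suc N
  proper-divisor-lifts zero    0∣n _ with () ← ℕ∣.0∣⇒≡0 0∣n
  proper-divisor-lifts (suc i) (ℕ∣.divides r n≡r*j) j<n =
    subst (j * q ℕ∣.∣_) (sym n≡r*j) (subst (ℕ∣._∣ r * j) (*-comm q j) (ℕ∣.*-monoˡ-∣ j q∣r))
    where
    j Y : ℕ
    j = suc i
    Y = N C i
    i<N : i < N
    i<N = s<s⁻¹ j<n
    jq∣j[Yr] : j * q ℕ∣.∣ j * (Y * r)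
    jq∣j[Yr] = subst (j * q ℕ∣.∣_) (begin
      j * (suc N C j)  ≡⟨ absorption N i (<⇒≤ i<N) ⟩
      suc N * Y        ≡⟨ cong (_* Y) n≡r*j ⟩
      (r * j) * Y      ≡⟨ regroup r j Y ⟩
      j * (Y * r)      ∎) (ℕ∣.*-monoʳ-∣ j (q∣next-row i i<N))
      where
      regroup : ∀ a b c → (a * b) * c ≡ b * (c * a)
      regroup = ℕRing.solve-∀
    q∣r : q ℕ∣.∣ r
    q∣r = coprime-divisor (row-coprime i (m<n⇒m<1+n i<N)) (ℕ∣.*-cancelˡ-∣ j jq∣j[Yr])

  instance
    q≢0 : NonZero q
    q≢0 = nonTrivial⇒nonZero q {{n>1⇒nonTrivial 1<q}}

  -- Climbing the powers of q: for each b, either n is a power of q or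
  -- q^b ∣ n.  A proper q^b ∣ n lifts to q^(b+1) ∣ n by the key lemma.
  power-or-divides : ∀ b → (∃[ m ] suc N ≡ q ^ m) ⊎ q ^ b ℕ∣.∣ suc N
  power-or-divides zero = inj₂ (ℕ∣.1∣ suc N)
  power-or-divides (suc b) with power-or-divides b
  ... | inj₁ n-power = inj₁ n-power
  ... | inj₂ qᵇ∣n with m≤n⇒m<n∨m≡n (ℕ∣.∣⇒≤ qᵇ∣n)
  ...   | inj₁ qᵇ<n = inj₂ (subst (ℕ∣._∣ suc N) (*-comm (q ^ b) q)
                              (proper-divisor-lifts (q ^ b) qᵇ∣n qᵇ<n))
  ...   | inj₂ qᵇ≡n = inj₁ (b , sym qᵇ≡n)

  n-is-power : ∃[ m ] suc N ≡ q ^ m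
  n-is-power with power-or-divides (suc N)
  ... | inj₁ n-power = n-power
  ... | inj₂ qⁿ∣n    = ⊥-elim (<⇒≱ (n<m^n q 1<q (suc N)) (ℕ∣.∣⇒≤ qⁿ∣n))

  q-irreducible : 1 < suc N → Irreducible q
  q-irreducible 1<n {d} d∣q with d ≟ q | n-is-power
  ... | yes d≡q | _             = inj₂ d≡q
  ... | no _    | zero , n≡1    = ⊥-elim (<-irrefl (sym n≡1) 1<n)
  ... | no d≢q  | suc m , n≡qᵐ⁺¹ = inj₁ (ℕ∣.∣1⇒≡1 (ℕ∣.*-cancelˡ-∣ (q * q ^ m) {{m^n≢0 q (suc m)}} qᵐ⁺¹d∣qᵐ⁺¹))
    where
    j : ℕ
    j = d * q ^ m
    j∣n : j ℕ∣.∣ suc N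
    j∣n = subst (j ℕ∣.∣_) (sym n≡qᵐ⁺¹) (ℕ∣.*-monoˡ-∣ (q ^ m) d∣q)
    j<n : j < suc N
    j<n = subst (j <_) (sym n≡qᵐ⁺¹) (*-monoˡ-< (q ^ m) {{m^n≢0 q m}} (≤∧≢⇒< (ℕ∣.∣⇒≤ d∣q) d≢q))
    qᵐ⁺¹d∣qᵐ⁺¹ : (q * q ^ m) * d ℕ∣.∣ (q * q ^ m) * 1
    qᵐ⁺¹d∣qᵐ⁺¹ = subst₂ ℕ∣._∣_ (regroup d (q ^ m) q) (trans n≡qᵐ⁺¹ (sym (*-identityʳ (q * q ^ m))))
                   (proper-divisor-lifts j j∣n j<n)
      where
      regroup : ∀ a b c → (a * b) * c ≡ (c * b) * a
      regroup = ℕRing.solve-∀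

theorem1p1 : (n q : ℕ) → 1 < n → 1 < q →
    ((k : ℕ) → k < n → (+ q) ∣ ((+ ((n ∸ 1) C k)) - (-1ℤ ^ℤ k))) →
    Prime q × ∃[ m ] n ≡ q ^ m
theorem1p1 (suc N) q 1<n 1<q row≡signs =
  irreducible⇒prime {{n>1⇒nonTrivial 1<q}} (q-irreducible 1<n) , n-is-power
  where open BinomialRowCongruence N q 1<q row≡signs
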